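{- Let $a,b,c$ be positive integers and let $\mathcal{G}$ be an $(a,b,c)$-copwin periodic graph with $n$ vertices and period $p\ge2$. Then for every integer $N\ge n$ there exists an $(a,b,c)$-copwin periodic graph $\mathcal{G}'$ with $N$ vertices and period $p$.
   Context: All graphs are finite, undirected and reflexive. A periodic graph with period $p\ge1$ is a sequence $\mathcal{G}=(G_0,\dots,G_{p-1})$ of graphs $G_i=(V,E_i)$ on a common vertex set $V$ (its vertices), extended by $G_{i+p}=G_i$, with $p$ minimal; its footprint is $G=(V,\bigcup_iE_i)$, assumed connected. Cops and Robber on a periodic graph with $k$ cops (perfect information): cops choose starting vertices, then the robber; in each round $t=0,1,\dots$ each cop moves to a vertex of $N_{G_{t\bmod p}}[\text{its position}]$, then the robber likewise; the cops win if a cop ever moves onto the robber's vertex. The cop number $c(\cdot)$ is the least $k$ such that $k$ cops have a winning strategy; a static graph is a periodic graph of period $1$. $\mathcal{G}$ is $(a,b,c)$-copwin if $c(G)=a$, $\max_{0\le i\le p-1}c(G_i)=b$ and $c(\mathcal{G})=c$. -}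

module Defs where

open import Data.Nat using (ℕ; zero; suc; _+_; _≤_; _<_; NonZero)
open import Data.Nat.DivMod using (_mod_)
open import Data.Fin using (Fin)
open import Data.Bool using (Bool; true; _∨_)
open import Data.Product using (Σ; ∃; ∃-syntax; _×_; _,_)
open import Data.Sum using (_⊎_)
open import Relation.Nullary using (¬_)
open import Relation.Binary.PropositionalEquality using (_≡_)

record Graph (n : ℕ) : Set where
  field
    adj      : Fin n → Fin n → Bool
    adj-refl : ∀ v → adj v v ≡ true
    adj-sym  : ∀ u v → adj u v ≡ adj v u
open Graph public

SameGraph : ∀ {n} → Graph n → Graph n → Set
SameGraph G H = ∀ u v → adj G u v ≡ adj H u v

data Reach {n} (G : Graph n) : Fin n → Fin n → Set where
  here : ∀ {u} → Reach G u u
  step : ∀ {u v w} → adj G u v ≡ true → Reach G v w → Reach G u w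

Connected : ∀ {n} → Graph n → Set
Connected {n} G = ∀ (u v : Fin n) → Reach G u v

-- Win Gs k t C r : at the start of round t, with cops at C and the
-- robber at r, the cops have a strategy forcing capture in finitely
-- many rounds (least fixed point = cop attractor of the reachability game).
data Win {n} (Gs : ℕ → Graph n) (k : ℕ) : ℕ → (Fin k → Fin n) → Fin n → Set where
  win : ∀ {t C r} (C' : Fin k → Fin n)
      → (∀ i → adj (Gs t) (C i) (C' i) ≡ true)
      → ((∃[ i ] C' i ≡ r)
         ⊎ (∀ r' → adj (Gs t) r r' ≡ true → Win Gs k (suc t) C' r'))
      → Win Gs k t C r

CopsWin : ∀ {n} → (ℕ → Graph n) → ℕ → Set
CopsWin {n} Gs k = Σ (Fin k → Fin n) λ C₀ → ∀ (r₀ : Fin n) → Win Gs k 0 C₀ r₀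

CopNumber : ∀ {n} → (ℕ → Graph n) → ℕ → Set
CopNumber Gs k = CopsWin Gs k × (∀ j → j < k → ¬ CopsWin Gs j)

static : ∀ {n} → Graph n → ℕ → Graph n
static G _ = G

extend : ∀ {n p} .{{_ : NonZero p}} → (Fin p → Graph n) → ℕ → Graph n
extend {p = p} Gs t = Gs (t mod p)

footprint : ∀ {n p} → (Fin p → Graph n) → Graph n
footprint {n} {zero} Gs = record { adj = λ u v → true ; adj-refl = λ _ → _≡_.refl ; adj-sym = λ _ _ → _≡_.refl }
footprint {n} {suc p} Gs = record
  { adj = λ u v → anyF (λ i → adj (Gs i) u v)
  ; adj-refl = λ v → anyF-true (λ i → adj (Gs i) v v) (adj-refl (Gs Fin.zero) v)
  ; adj-sym = λ u v → anyF-cong (λ i → adj-sym (Gs i) u v) }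
  where
  anyF : ∀ {m} → (Fin (suc m) → Bool) → Bool
  anyF {zero} f = f Fin.zero
  anyF {suc m} f = f Fin.zero ∨ anyF (λ i → f (Fin.suc i))
  anyF-true : ∀ {m} (f : Fin (suc m) → Bool) → f Fin.zero ≡ true → anyF f ≡ true
  anyF-true {zero} f e = e
  anyF-true {suc m} f e rewrite e = _≡_.refl
  anyF-cong : ∀ {m} {f g : Fin (suc m) → Bool} → (∀ i → f i ≡ g i) → anyF f ≡ anyF g
  anyF-cong {zero} e = e Fin.zero
  anyF-cong {suc m} {f} {g} e rewrite e Fin.zero | anyF-cong {m} {λ i → f (Fin.suc i)} {λ i → g (Fin.suc i)} (λ i → e (Fin.suc i)) = _≡_.refl

record PeriodicGraph (n p : ℕ) .{{_ : NonZero p}} : Set where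
  field
    layer     : Fin p → Graph n
    minimal   : ∀ q → 1 ≤ q → q < p →
                ¬ (∀ (t : ℕ) → SameGraph (extend layer (t + q)) (extend layer t))
    connected : Connected (footprint layer)
open PeriodicGraph public

ABCCopwin : ∀ {n p} .{{_ : NonZero p}} → PeriodicGraph n p → ℕ → ℕ → ℕ → Set
ABCCopwin {n} {p} 𝒢 a b c =
  CopNumber (static (footprint (layer 𝒢))) a
  × ((∃[ i ] CopNumber (static (layer 𝒢 i)) b)
     × (∀ i m → CopNumber (static (layer 𝒢 i)) m → m ≤ b))
  × CopNumber (extend (layer 𝒢)) c

-- Blow up a vertex v₀ of 𝒢 into N − n + 1 pairwise adjacent twins: pull every layer back along a
-- retraction Fin N → Fin n that sends the new vertices to v₀.  In any layer, cops and robber on the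
-- big graph can be shadowed by their images in 𝒢, and conversely positions in 𝒢 can be lifted
-- through the section; a cop standing on the robber's image is moved onto the robber himself.  So
-- every cop number, the connectivity of the footprint and the minimal period are all preserved.
{-# OPTIONS --safe #-}
module Submission where

open import Defs
open import Data.Nat using (ℕ; zero; suc; _+_; _≤_; _<_; _<?_; NonZero)
open import Data.Fin using (Fin; toℕ; fromℕ<; inject≤; _≟_)
open import Data.Fin.Properties using (toℕ-inject≤; toℕ-fromℕ<; toℕ-injective; toℕ<n)
open import Data.Bool using (true)
open import Data.Product using (Σ; _,_)
open import Data.Sum using (inj₁; inj₂)
open import Function using (_∘_)
open import Relation.Nullary using (yes; no; contradiction)
open import Relation.Binary.PropositionalEquality

module PullbackAlongRetraction {n N : ℕ} (f : Fin N → Fin n) (s : Fin n → Fin N)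
                               (f∘s : ∀ x → f (s x) ≡ x) where

  pullback : Graph n → Graph N
  pullback G = record
    { adj      = λ x y → adj G (f x) (f y)
    ; adj-refl = λ x → adj-refl G (f x)
    ; adj-sym  = λ x y → adj-sym G (f x) (f y)
    }

  pullback-reflects-SameGraph : ∀ {G H} → SameGraph (pullback G) (pullback H) → SameGraph G H
  pullback-reflects-SameGraph {G} {H} same u v = begin
    adj G u v                 ≡⟨ sym (cong₂ (adj G) (f∘s u) (f∘s v)) ⟩
    adj G (f (s u)) (f (s v)) ≡⟨ same (s u) (s v) ⟩
    adj H (f (s u)) (f (s v)) ≡⟨ cong₂ (adj H) (f∘s u) (f∘s v) ⟩
    adj H u v                 ∎
    where open ≡-Reasoning

  _IsPullbackOf_ : Graph N → Graph n → Set
  H IsPullbackOf G = ∀ x y → adj H x y ≡ adj G (f x) (f y)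

  pullback-isPullbackOf : ∀ G → pullback G IsPullbackOf G
  pullback-isPullbackOf G x y = refl

  -- Stated for a successor period because footprint only computes there.
  footprint-pullback : ∀ {p} (L : Fin (suc p) → Graph n) → footprint (pullback ∘ L) IsPullbackOf footprint L
  footprint-pullback L x y = refl

  Reach-pullback : ∀ {G H} → H IsPullbackOf G → ∀ {x y u} → f x ≡ u → Reach G u (f y) → Reach H x y
  Reach-pullback {G} H≗G {x} fx≡u here =
    step (trans (H≗G x _) (trans (cong (adj G (f x)) (sym fx≡u)) (adj-refl G (f x)))) here
  Reach-pullback {G} H≗G {x} fx≡u (step {v = v} u~v path) =
    step (trans (H≗G x (s v)) (trans (cong₂ (adj G) fx≡u (f∘s v)) u~v)) (Reach-pullback H≗G (f∘s v) path)

  liftTowards : Fin N → Fin n → Fin N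
  liftTowards r c with c ≟ f r
  ... | yes _ = r
  ... | no  _ = s c

  f∘liftTowards : ∀ r c → f (liftTowards r c) ≡ c
  f∘liftTowards r c with c ≟ f r
  ... | yes c≡fr = sym c≡fr
  ... | no  _    = f∘s c

  liftTowards-hit : ∀ r c → c ≡ f r → liftTowards r c ≡ r
  liftTowards-hit r c c≡fr with c ≟ f r
  ... | yes _    = refl
  ... | no  c≢fr = contradiction c≡fr c≢fr

  module _ (Gs : ℕ → Graph n) (Hs : ℕ → Graph N) (Hs≗Gs : ∀ t → Hs t IsPullbackOf Gs t) {k : ℕ} where

    Win-lift : ∀ {t C r} (D : Fin k → Fin N) → (∀ i → f (D i) ≡ C i)
             → Win Gs k t C (f r) → Win Hs k t D r
    Win-lift {t} {C} {r} D fD≡C (win C′ moves outcome) = win D′ moves′ (outcome′ outcome)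
      where
      D′ : Fin k → Fin N
      D′ i = liftTowards r (C′ i)

      moves′ : ∀ i → adj (Hs t) (D i) (D′ i) ≡ true
      moves′ i = trans (Hs≗Gs t (D i) (D′ i))
                       (trans (cong₂ (adj (Gs t)) (fD≡C i) (f∘liftTowards r (C′ i))) (moves i))

      outcome′ : _ → _
      outcome′ (inj₁ (i , C′i≡fr)) = inj₁ (i , liftTowards-hit r (C′ i) C′i≡fr)
      outcome′ (inj₂ next) = inj₂ λ r′ r~r′ →
        Win-lift D′ (f∘liftTowards r ∘ C′) (next (f r′) (trans (sym (Hs≗Gs t r r′)) r~r′))

    Win-push : ∀ {t D r′ r} → f r′ ≡ r → Win Hs k t D r′ → Win Gs k t (f ∘ D) r
    Win-push {t} {D} {r′} {r} fr′≡r (win D′ moves outcome) = win (f ∘ D′) moves′ (outcome′ outcome)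
      where
      moves′ : ∀ i → adj (Gs t) (f (D i)) (f (D′ i)) ≡ true
      moves′ i = trans (sym (Hs≗Gs t (D i) (D′ i))) (moves i)

      outcome′ : _ → _
      outcome′ (inj₁ (i , D′i≡r′)) = inj₁ (i , trans (cong f D′i≡r′) fr′≡r)
      outcome′ (inj₂ next) = inj₂ λ r₂ r~r₂ → Win-push (f∘s r₂) (next (s r₂)
        (trans (Hs≗Gs t r′ (s r₂)) (trans (cong₂ (adj (Gs t)) fr′≡r (f∘s r₂)) r~r₂)))

    CopsWin-lift : CopsWin Gs k → CopsWin Hs k
    CopsWin-lift (C₀ , wins) = s ∘ C₀ , λ r → Win-lift (s ∘ C₀) (f∘s ∘ C₀) (wins (f r))

    CopsWin-push : CopsWin Hs k → CopsWin Gs k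
    CopsWin-push (D₀ , wins) = f ∘ D₀ , λ r → Win-push (f∘s r) (wins (s r))

  CopNumber-pullback : ∀ Gs Hs → (∀ t → Hs t IsPullbackOf Gs t) → ∀ {k} → CopNumber Gs k → CopNumber Hs k
  CopNumber-pullback Gs Hs Hs≗Gs (wins , fewerLose) =
    CopsWin-lift Gs Hs Hs≗Gs wins , λ j j<k → fewerLose j j<k ∘ CopsWin-push Gs Hs Hs≗Gs

  CopNumber-pullback⁻ : ∀ Gs Hs → (∀ t → Hs t IsPullbackOf Gs t) → ∀ {k} → CopNumber Hs k → CopNumber Gs k
  CopNumber-pullback⁻ Gs Hs Hs≗Gs (wins , fewerLose) =
    CopsWin-push Gs Hs Hs≗Gs wins , λ j j<k → fewerLose j j<k ∘ CopsWin-lift Gs Hs Hs≗Gs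

  module _ {p : ℕ} (𝒢 : PeriodicGraph n (suc p)) where

    private
      L : Fin (suc p) → Graph n
      L = layer 𝒢

    pullbackPeriodic : PeriodicGraph N (suc p)
    pullbackPeriodic = record
      { layer     = pullback ∘ L
      ; minimal   = λ q 1≤q q<p periodic →
          minimal 𝒢 q 1≤q q<p λ t →
            pullback-reflects-SameGraph {extend L (t + q)} {extend L t} (periodic t)
      ; connected = λ u v → Reach-pullback (footprint-pullback L) refl (connected 𝒢 (f u) (f v))
      }

    ABCCopwin-pullback : ∀ {a b c} → ABCCopwin 𝒢 a b c → ABCCopwin pullbackPeriodic a b c
    ABCCopwin-pullback (footprintNumber , ((i , layerNumber) , layerBound) , periodicNumber) =
        CopNumber-pullback (static (footprint L)) (static (footprint (pullback ∘ L)))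
                           (λ _ → footprint-pullback L) footprintNumber
      , ((i , CopNumber-pullback (static (L i)) (static (pullback (L i)))
                                 (λ _ → pullback-isPullbackOf (L i)) layerNumber)
        , λ j m → layerBound j m ∘ CopNumber-pullback⁻ (static (L j)) (static (pullback (L j)))
                                                       (λ _ → pullback-isPullbackOf (L j)))
      , CopNumber-pullback (extend L) (extend (pullback ∘ L))
                           (λ t → pullback-isPullbackOf (extend L t)) periodicNumber

retractOnto : ∀ {n N} → Fin (suc n) → Fin N → Fin (suc n)
retractOnto {n} default x with toℕ x <? suc n
... | yes x<1+n = fromℕ< x<1+n
... | no  _     = default

retractOnto-inject≤ : ∀ {n N} (n<N : suc n ≤ N) default (x : Fin (suc n))
                    → retractOnto default (inject≤ x n<N) ≡ x
retractOnto-inject≤ {n} n<N default x with toℕ (inject≤ x n<N) <? suc n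
... | yes x<1+n = toℕ-injective (trans (toℕ-fromℕ< x<1+n) (toℕ-inject≤ x n<N))
... | no  x≮1+n = contradiction (subst (_< suc n) (sym (toℕ-inject≤ x n<N)) (toℕ<n x)) x≮1+n

lemma3 : (a b c n p : ℕ) .{{_ : NonZero p}} → 1 ≤ a → 1 ≤ b → 1 ≤ c → 2 ≤ p
    → (𝒢 : PeriodicGraph n p) → ABCCopwin 𝒢 a b c
    → (N : ℕ) → n ≤ N
    → Σ (PeriodicGraph N p) (λ 𝒢′ → ABCCopwin 𝒢′ a b c)
lemma3 (suc a) b c zero p _ _ _ _ 𝒢 (((C₀ , _) , _) , _) N n≤N with C₀ Fin.zero
... | ()
lemma3 a b c (suc n) (suc p) _ _ _ _ 𝒢 copwin N n≤N =
  pullbackPeriodic 𝒢 , ABCCopwin-pullback 𝒢 copwin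
  where
  open PullbackAlongRetraction (retractOnto Fin.zero) (λ x → inject≤ x n≤N)
                               (retractOnto-inject≤ n≤N Fin.zero)
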